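{- Let $k\geq 3$ and let $p$ be the partially ordered pattern of length $k$ on the labels $\{1,\dots,k\}$ whose only relation is $1>3$ (all other pairs of labels are incomparable). Let $a(n)$ be the number of $n$-permutations avoiding $p$. Then $$a(n)=\begin{cases} n! & \text{if } n<k,\\ \dfrac{n!}{(n-k+3)!}\,F(n-k+4) & \text{if } n\geq k,\end{cases}$$ where $F$ denotes the Fibonacci numbers with $F(1)=F(2)=1$ and $F(m)=F(m-1)+F(m-2)$.
   Context: An $n$-permutation is a permutation $\pi=\pi_1\cdots\pi_n$ of $\{1,\dots,n\}$ written in one-line notation (for $n=0$ there is exactly one, the empty permutation). A partially ordered pattern (POP) $p$ of length $k$ is a partial order $<_P$ on the label set $\{1,\dots,k\}$. An occurrence of $p$ in $\pi$ is a subsequence $\pi_{i_1}\pi_{i_2}\cdots\pi_{i_k}$ with $1\leq i_1<\cdots<i_k\leq n$ such that $\pi_{i_j}<\pi_{i_m}$ whenever $j<_P m$ (no condition is imposed on pairs of incomparable labels). A permutation avoids $p$ if it contains no occurrence of $p$. -}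

module Defs where

open import Data.Nat using (ℕ; zero; suc; _+_; _*_; _∸_; _<_; _≤_; _!)
open import Data.Nat.DivMod using (_/_)
open import Data.Nat.Properties using (_!≢0)
open import Data.Fin using (Fin; toℕ) renaming (_<_ to _<ᶠ_)
open import Data.Vec using (Vec; lookup)
open import Data.List using (List; length)
open import Data.List.Membership.Propositional using (_∈_)
open import Data.List.Relation.Unary.Unique.Propositional using (Unique)
open import Data.Product using (Σ; ∃; _×_)
open import Relation.Nullary using (¬_)
open import Relation.Binary.PropositionalEquality using (_≡_)
open import Function.Definitions using (Injective)
open import Function.Bundles using (_⇔_)

-- An n-permutation in one-line notation: a vector π of length n with entries in
-- Fin n (values 0..n-1 standing for 1..n), all entries distinct.
IsPerm : ∀ {n} → Vec (Fin n) n → Set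
IsPerm {n} π = Injective _≡_ _≡_ (lookup π)

-- A partially ordered pattern of length k: a (strict) relation on the labels Fin k
-- (label j+1 of the paper is Fin element j).  a <P b means "a <_P b".
POP : ℕ → Set₁
POP k = Fin k → Fin k → Set

Occurs : ∀ {k n} → POP k → Vec (Fin n) n → Set
Occurs {k} {n} p π =
  Σ (Fin k → Fin n) λ i →
    (∀ a b → a <ᶠ b → i a <ᶠ i b) ×
    (∀ a b → p a b → lookup π (i a) <ᶠ lookup π (i b))

Avoids : ∀ {k n} → POP k → Vec (Fin n) n → Set
Avoids p π = ¬ Occurs p π

-- The POP of length k whose only relation is 1 > 3, i.e. 3 <_P 1.
-- Label 3 is Fin element with toℕ = 2, label 1 has toℕ = 0.
p13 : (k : ℕ) → POP k
p13 k a b = (toℕ a ≡ 2) × (toℕ b ≡ 0)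

NumAvoiders : ∀ {k} → POP k → ℕ → ℕ → Set
NumAvoiders p n m =
  Σ (List (Vec (Fin n) n)) λ L →
    Unique L ×
    (∀ π → (π ∈ L) ⇔ (IsPerm π × Avoids p π)) ×
    (length L ≡ m)

F : ℕ → ℕ
F zero = zero
F (suc zero) = suc zero
F (suc (suc m)) = F (suc m) + F m

-- n! / (n-k+3)! * F(n-k+4)   (exact division; used for n ≥ k)
formula : ℕ → ℕ → ℕ
formula k n =
  _/_ (n !) ((n ∸ k + 3) !) {{(n ∸ k + 3) !≢0}} * F (n ∸ k + 4)

module Submission where

-- Write k = s + 3.  An occurrence of p in y is essentially a pair of positions a + 2 ≤ c with
-- y(c) < y(a) and at least s positions after c, so y avoids p iff y(a) < y(c) whenever
-- c ≥ a + 2 and c + s < n.  Reading y backwards, ρ = reverse y must satisfy ρ(i) < ρ(j)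
-- whenever s ≤ j and j + 2 ≤ i.  The first s entries of ρ are unconstrained: prepending an
-- arbitrary value (shifting the larger values up) to the ρ of length n - 1 valid for s gives
-- exactly the ρ of length n valid for s + 1, whence the factor n (n-1) ⋯ (n-s+1) = n!/(n-s)!.
-- For s = 0 every entry exceeds all entries two or more places later, so the first entry is
-- the largest or the second largest value, and in the latter case the largest comes second;
-- deleting one or two entries gives F(n+1) = F(n) + F(n-1) such permutations.  If n < k the
-- condition is vacuous and all n! permutations avoid p.

open import Defs
open import Data.Nat using (ℕ; zero; suc; _+_; _*_; _∸_; _≤_; _<_; _!; z≤n; s≤s)
open import Data.Nat.Properties
open import Data.Nat.Combinatorics using (_P_; nPk≡n!/[n∸k]!; nPn≡n!)
open import Data.Nat.DivMod using (_/_; *-/-assoc)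
open import Data.Nat.Divisibility using (m≤n⇒m!∣n!)
open import Data.Fin using (Fin; zero; suc; toℕ; fromℕ; fromℕ<; inject₁; punchIn; punchOut; opposite;
  splitAt; join; _↑ˡ_; _↑ʳ_; remQuot; combine) renaming (_<_ to _<ᶠ_)
import Data.Fin.Properties as Finₚ
open import Data.Vec using (Vec; []; _∷_; lookup; map; tabulate; head)
open import Data.Vec.Properties
  using (∷-injective; lookup-map; lookup∘tabulate; tabulate∘lookup; tabulate-cong; tabulate-∘)
import Data.List as List
open import Data.List.Properties using (length-tabulate)
open import Data.List.Membership.Propositional using (_∈_)
open import Data.List.Membership.Propositional.Properties using (∈-tabulate⁺; ∈-tabulate⁻)
open import Data.List.Relation.Unary.Unique.Propositional.Properties using (tabulate⁺)
open import Data.Product using (∃; ∃₂; _×_; _,_; proj₁; proj₂; map₂; uncurry)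
open import Data.Product.Properties using (,-injective)
open import Data.Sum using (_⊎_; inj₁; inj₂; [_,_]′)
open import Data.Empty using (⊥; ⊥-elim)
open import Function using (_∘_)
open import Function.Bundles using (_⇔_; mk⇔; Equivalence)
open import Function.Definitions using (Injective)
open import Function.Consequences.Propositional using (inverseʳ⇒injective; strictlyInverseʳ⇒inverseʳ)
open import Relation.Binary.Definitions using (tri<; tri≈; tri>)
open import Relation.Binary.PropositionalEquality

open Equivalence using (to; from)

record Enumeration {A : Set} (R : A → Set) (m : ℕ) : Set where
  field
    enum           : Fin m → A
    enum-injective : Injective _≡_ _≡_ enum
    enum-sound     : ∀ i → R (enum i)
    enum-complete  : ∀ x → R x → ∃ λ i → enum i ≡ x

open Enumeration

Image : {A B : Set} → (A → Set) → (A → B) → B → Set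
Image R f y = ∃ λ x → R x × f x ≡ y

module _ {A : Set} {R : A → Set} {m : ℕ} where

  enumeration-image : {B : Set} → Enumeration R m → (f : A → B) → Injective _≡_ _≡_ f →
    Enumeration (Image R f) m
  enumeration-image E f f-injective = record
    { enum           = f ∘ enum E
    ; enum-injective = enum-injective E ∘ f-injective
    ; enum-sound     = λ i → enum E i , enum-sound E i , refl
    ; enum-complete  = complete
    }
    where
    complete : ∀ y → Image R f y → ∃ λ i → f (enum E i) ≡ y
    complete y (x , rx , refl) = map₂ (cong f) (enum-complete E x rx)

  enumeration-resp : {S : A → Set} → (∀ x → R x ⇔ S x) → Enumeration R m → Enumeration S m
  enumeration-resp R⇔S E = record
    { enum           = enum E
    ; enum-injective = enum-injective E
    ; enum-sound     = λ i → to (R⇔S (enum E i)) (enum-sound E i)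
    ; enum-complete  = λ x → enum-complete E x ∘ from (R⇔S x)
    }

  enumeration-⊎ : {S : A → Set} {m′ : ℕ} → Enumeration R m → Enumeration S m′ →
    (∀ {x} → R x → S x → ⊥) → Enumeration (λ x → R x ⊎ S x) (m + m′)
  enumeration-⊎ {S} {m′} E₁ E₂ disjoint = record
    { enum           = enum⊎ ∘ splitAt m
    ; enum-injective = injective
    ; enum-sound     = sound ∘ splitAt m
    ; enum-complete  = complete
    }
    where
    enum⊎ : Fin m ⊎ Fin m′ → A
    enum⊎ = [ enum E₁ , enum E₂ ]′

    enum⊎-injective : Injective _≡_ _≡_ enum⊎
    enum⊎-injective {inj₁ i} {inj₁ j} eq = cong inj₁ (enum-injective E₁ eq)
    enum⊎-injective {inj₁ i} {inj₂ j} eq = ⊥-elim (disjoint (enum-sound E₁ i) (subst S (sym eq) (enum-sound E₂ j)))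
    enum⊎-injective {inj₂ i} {inj₁ j} eq = ⊥-elim (disjoint (enum-sound E₁ j) (subst S eq (enum-sound E₂ i)))
    enum⊎-injective {inj₂ i} {inj₂ j} eq = cong inj₂ (enum-injective E₂ eq)

    injective : Injective _≡_ _≡_ (enum⊎ ∘ splitAt m)
    injective {i} {j} eq = begin
      i                       ≡⟨ Finₚ.join-splitAt m m′ i ⟨
      join m m′ (splitAt m i) ≡⟨ cong (join m m′) (enum⊎-injective {splitAt m i} {splitAt m j} eq) ⟩
      join m m′ (splitAt m j) ≡⟨ Finₚ.join-splitAt m m′ j ⟩
      j                       ∎
      where open ≡-Reasoning

    sound : ∀ s → R (enum⊎ s) ⊎ S (enum⊎ s)
    sound (inj₁ i) = inj₁ (enum-sound E₁ i)
    sound (inj₂ j) = inj₂ (enum-sound E₂ j)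

    complete : ∀ x → R x ⊎ S x → ∃ λ i → enum⊎ (splitAt m i) ≡ x
    complete x (inj₁ rx) with enum-complete E₁ x rx
    ... | i , eq = i ↑ˡ m′ , trans (cong enum⊎ (Finₚ.splitAt-↑ˡ m i m′)) eq
    complete x (inj₂ sx) with enum-complete E₂ x sx
    ... | j , eq = m ↑ʳ j , trans (cong enum⊎ (Finₚ.splitAt-↑ʳ m m′ j)) eq

  enumeration-× : (k : ℕ) → Enumeration R m → Enumeration (R ∘ proj₂) (k * m)
  enumeration-× k E = record
    { enum           = enum×
    ; enum-injective = injective
    ; enum-sound     = λ i → enum-sound E (proj₂ (remQuot {k} m i))
    ; enum-complete  = complete
    }
    where
    enum× : Fin (k * m) → Fin k × A
    enum× = map₂ (enum E) ∘ remQuot {k} m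

    injective : Injective _≡_ _≡_ enum×
    injective {i} {j} eq with ,-injective eq
    ... | eq₁ , eq₂ = begin
      i                                 ≡⟨ Finₚ.combine-remQuot {k} m i ⟨
      uncurry combine (remQuot {k} m i) ≡⟨ cong₂ combine eq₁ (enum-injective E eq₂) ⟩
      uncurry combine (remQuot {k} m j) ≡⟨ Finₚ.combine-remQuot {k} m j ⟩
      j                                 ∎
      where open ≡-Reasoning

    complete : ∀ vx → R (proj₂ vx) → ∃ λ i → enum× i ≡ vx
    complete (v , x) rx with enum-complete E x rx
    ... | i , refl = combine v i , cong (map₂ (enum E)) (Finₚ.remQuot-combine {k} {m} v i)

numAvoiders : ∀ {k n m} {p : POP k} → Enumeration (λ π → IsPerm π × Avoids p π) m → NumAvoiders p n m
numAvoiders {p = p} E =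
  List.tabulate (enum E) ,
  tabulate⁺ (enum-injective E) ,
  (λ π → mk⇔
    (λ π∈ → let i , eq = ∈-tabulate⁻ π∈ in subst (λ σ → IsPerm σ × Avoids p σ) (sym eq) (enum-sound E i))
    (λ h → let i , eq = enum-complete E π h in subst (_∈ List.tabulate (enum E)) eq (∈-tabulate⁺ i))) ,
  length-tabulate (enum E)

prepend : ∀ {n} → Fin (suc n) → Vec (Fin n) n → Vec (Fin (suc n)) (suc n)
prepend v ρ = v ∷ map (punchIn v) ρ

lookup-prepend : ∀ {n} (v : Fin (suc n)) (ρ : Vec (Fin n) n) i → lookup (prepend v ρ) (suc i) ≡ punchIn v (lookup ρ i)
lookup-prepend v ρ i = lookup-map i (punchIn v) ρ

map-injective : ∀ {A B : Set} {n} {f : A → B} → Injective _≡_ _≡_ f → Injective _≡_ _≡_ (map {n = n} f)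
map-injective f-injective {[]} {[]} _ = refl
map-injective f-injective {x ∷ xs} {y ∷ ys} eq with ∷-injective eq
... | fx≡fy , eq′ = cong₂ _∷_ (f-injective fx≡fy) (map-injective f-injective eq′)

prepend-injective : ∀ {n} {v w : Fin (suc n)} {ρ σ : Vec (Fin n) n} →
  prepend v ρ ≡ prepend w σ → v ≡ w × ρ ≡ σ
prepend-injective {v = v} eq with ∷-injective eq
... | refl , eq′ = refl , map-injective (Finₚ.punchIn-injective v _ _) eq′

prepend-isPerm : ∀ {n} (v : Fin (suc n)) {ρ : Vec (Fin n) n} → IsPerm ρ → IsPerm (prepend v ρ)
prepend-isPerm v     _      {zero}  {zero}  _  = refl
prepend-isPerm v {ρ} _      {zero}  {suc j} eq =
  ⊥-elim (Finₚ.punchInᵢ≢i v (lookup ρ j) (sym (trans eq (lookup-prepend v ρ j))))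
prepend-isPerm v {ρ} _      {suc i} {zero}  eq =
  ⊥-elim (Finₚ.punchInᵢ≢i v (lookup ρ i) (trans (sym (lookup-prepend v ρ i)) eq))
prepend-isPerm v {ρ} ρ-perm {suc i} {suc j} eq =
  cong suc (ρ-perm (Finₚ.punchIn-injective v _ _ (trans (sym (lookup-prepend v ρ i)) (trans eq (lookup-prepend v ρ j)))))

isPerm⇒prepend : ∀ {n} {π : Vec (Fin (suc n)) (suc n)} → IsPerm π →
  ∃₂ λ v ρ → IsPerm ρ × prepend v ρ ≡ π
isPerm⇒prepend {n} {v ∷ τ} π-perm = v , ρ , ρ-perm , cong (v ∷_) map-punchIn-ρ
  where
  v≢τ : ∀ i → v ≢ lookup τ i
  v≢τ i eq with π-perm {zero} {suc i} eq
  ... | ()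

  ρ : Vec (Fin n) n
  ρ = tabulate (λ i → punchOut (v≢τ i))

  map-punchIn-ρ : map (punchIn v) ρ ≡ τ
  map-punchIn-ρ = begin
    map (punchIn v) ρ                             ≡⟨ tabulate-∘ (punchIn v) _ ⟨
    tabulate (λ i → punchIn v (punchOut (v≢τ i))) ≡⟨ tabulate-cong (λ i → Finₚ.punchIn-punchOut (v≢τ i)) ⟩
    tabulate (lookup τ)                           ≡⟨ tabulate∘lookup τ ⟩
    τ                                             ∎
    where open ≡-Reasoning

  ρ-perm : IsPerm ρ
  ρ-perm {i} {j} eq = Finₚ.suc-injective (π-perm (Finₚ.punchOut-injective (v≢τ i) (v≢τ j)
    (trans (sym (lookup∘tabulate _ i)) (trans eq (lookup∘tabulate _ j)))))

punchIn-mono-< : ∀ {n} (v : Fin (suc n)) {a b : Fin n} → a <ᶠ b → punchIn v a <ᶠ punchIn v b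
punchIn-mono-< v {a} {b} a<b =
  Finₚ.≤∧≢⇒< (Finₚ.punchIn-mono-≤ v a b (<⇒≤ a<b)) (Finₚ.<⇒≢ a<b ∘ Finₚ.punchIn-injective v a b)

punchIn-cancel-< : ∀ {n} (v : Fin (suc n)) {a b : Fin n} → punchIn v a <ᶠ punchIn v b → a <ᶠ b
punchIn-cancel-< v {a} {b} lt =
  Finₚ.≤∧≢⇒< (Finₚ.punchIn-cancel-≤ v a b (<⇒≤ lt)) (Finₚ.<⇒≢ lt ∘ cong (punchIn v))

toℕ≤toℕ-punchIn : ∀ {n} (v : Fin (suc n)) (a : Fin n) → toℕ a ≤ toℕ (punchIn v a)
toℕ≤toℕ-punchIn zero    a       = n≤1+n (toℕ a)
toℕ≤toℕ-punchIn (suc v) zero    = z≤n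
toℕ≤toℕ-punchIn (suc v) (suc a) = s≤s (toℕ≤toℕ-punchIn v a)

toℕ-punchIn-below : ∀ {n} {v : Fin (suc n)} {a : Fin n} → a <ᶠ v → toℕ (punchIn v a) ≡ toℕ a
toℕ-punchIn-below {v = suc v} {zero}  _         = refl
toℕ-punchIn-below {v = suc v} {suc a} (s≤s a<v) = cong suc (toℕ-punchIn-below a<v)

SkipDecreasing : ∀ {n} → ℕ → Vec (Fin n) n → Set
SkipDecreasing {n} s ρ = ∀ (j i : Fin n) → s ≤ toℕ j → 2 + toℕ j ≤ toℕ i → lookup ρ i <ᶠ lookup ρ j

SkipDecreasingPerm : ∀ {n} → ℕ → Vec (Fin n) n → Set
SkipDecreasingPerm s ρ = IsPerm ρ × SkipDecreasing s ρ

skipDecreasing-short : ∀ {n s} → n ≤ 2 + s → (ρ : Vec (Fin n) n) → SkipDecreasing s ρ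
skipDecreasing-short n≤2+s ρ j i s≤j 2+j≤i =
  ⊥-elim (<⇒≱ (Finₚ.toℕ<n i) (≤-trans n≤2+s (≤-trans (+-monoʳ-≤ 2 s≤j) 2+j≤i)))

skipDecreasing-suc-prepend : ∀ {n s} (v : Fin (suc n)) (ρ : Vec (Fin n) n) →
  SkipDecreasing (suc s) (prepend v ρ) ⇔ SkipDecreasing s ρ
skipDecreasing-suc-prepend v ρ = mk⇔ tail-sd prepend-sd
  where
  tail-sd : SkipDecreasing _ (prepend v ρ) → SkipDecreasing _ ρ
  tail-sd sd j i s≤j 2+j≤i = punchIn-cancel-< v
    (subst₂ _<ᶠ_ (lookup-prepend v ρ i) (lookup-prepend v ρ j) (sd (suc j) (suc i) (s≤s s≤j) (s≤s 2+j≤i)))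

  prepend-sd : SkipDecreasing _ ρ → SkipDecreasing _ (prepend v ρ)
  prepend-sd sd (suc j) (suc i) (s≤s s≤j) (s≤s 2+j≤i) =
    subst₂ _<ᶠ_ (sym (lookup-prepend v ρ i)) (sym (lookup-prepend v ρ j)) (punchIn-mono-< v (sd j i s≤j 2+j≤i))

skipDecreasing-zero-prepend : ∀ {n} (v : Fin (suc n)) (ρ : Vec (Fin n) n) →
  SkipDecreasing 0 (prepend v ρ) ⇔ (SkipDecreasing 0 ρ × ∀ i → 1 ≤ toℕ i → lookup ρ i <ᶠ v)
skipDecreasing-zero-prepend v ρ = mk⇔
  (λ sd → to (skipDecreasing-suc-prepend v ρ) (λ j i _ → sd j i z≤n) , below-head sd)
  (λ (sd , below) → prepend-sd sd below)
  where
  below-head : SkipDecreasing 0 (prepend v ρ) → ∀ i → 1 ≤ toℕ i → lookup ρ i <ᶠ v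
  below-head sd i 1≤i = ≤-<-trans (toℕ≤toℕ-punchIn v (lookup ρ i))
    (subst (_<ᶠ v) (lookup-prepend v ρ i) (sd zero (suc i) z≤n (s≤s 1≤i)))

  prepend-sd : SkipDecreasing 0 ρ → (∀ i → 1 ≤ toℕ i → lookup ρ i <ᶠ v) → SkipDecreasing 0 (prepend v ρ)
  prepend-sd sd below zero (suc i) _ (s≤s 1≤i) = subst (_<ᶠ v) (sym (lookup-prepend v ρ i))
    (subst (_< toℕ v) (sym (toℕ-punchIn-below (below i 1≤i))) (below i 1≤i))
  prepend-sd sd below (suc j) i _ 2+j≤i = from (skipDecreasing-suc-prepend v ρ) sd (suc j) i (s≤s z≤n) 2+j≤i

injective-below⇒≤ : ∀ {m n} (f : Fin m → Fin n) → Injective _≡_ _≡_ f →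
  (b : ℕ) → (∀ i → toℕ (f i) < b) → m ≤ b
injective-below⇒≤ f f-injective b f<b = Finₚ.injective⇒≤ {f = g} g-injective
  where
  g : _ → Fin b
  g i = fromℕ< (f<b i)

  g-injective : Injective _≡_ _≡_ g
  g-injective {i} {j} eq = f-injective (Finₚ.toℕ-injective
    (trans (sym (Finₚ.toℕ-fromℕ< (f<b i))) (trans (cong toℕ eq) (Finₚ.toℕ-fromℕ< (f<b j)))))

<ᶠ-fromℕ : ∀ {n} (a : Fin n) → a <ᶠ fromℕ n
<ᶠ-fromℕ {n} a = subst (toℕ a <_) (sym (Finₚ.toℕ-fromℕ n)) (Finₚ.toℕ<n a)

prependMax : ∀ {n} → Vec (Fin n) n → Vec (Fin (suc n)) (suc n)
prependMax {n} = prepend (fromℕ n)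

skipDecreasing-prependMax : ∀ {n} {ρ : Vec (Fin n) n} → SkipDecreasing 0 ρ → SkipDecreasing 0 (prependMax ρ)
skipDecreasing-prependMax {n} {ρ} sd =
  from (skipDecreasing-zero-prepend (fromℕ n) ρ) (sd , λ i _ → <ᶠ-fromℕ (lookup ρ i))

secondLast : ∀ k → Fin (2 + k)
secondLast k = inject₁ (fromℕ k)

toℕ-secondLast : ∀ k → toℕ (secondLast k) ≡ k
toℕ-secondLast k = trans (Finₚ.toℕ-inject₁ (fromℕ k)) (Finₚ.toℕ-fromℕ k)

prepend₂ : ∀ {k} → Vec (Fin k) k → Vec (Fin (2 + k)) (2 + k)
prepend₂ {k} = prepend (secondLast k) ∘ prependMax

skipDecreasing-prepend₂ : ∀ {k} {ρ : Vec (Fin k) k} → SkipDecreasing 0 ρ → SkipDecreasing 0 (prepend₂ ρ)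
skipDecreasing-prepend₂ {k} {ρ} sd = from (skipDecreasing-zero-prepend (secondLast k) (prependMax ρ))
  (skipDecreasing-prependMax sd , below)
  where
  below : ∀ i → 1 ≤ toℕ i → lookup (prependMax ρ) i <ᶠ secondLast k
  below (suc i) _ = subst₂ _<_ (cong toℕ (sym (lookup-prepend (fromℕ k) ρ i))) (sym (toℕ-secondLast k))
    (subst (_< k) (sym (toℕ-punchIn-below (<ᶠ-fromℕ (lookup ρ i)))) (Finₚ.toℕ<n (lookup ρ i)))

perm-tail-below⇒≤ : ∀ {k b} {ρ : Vec (Fin (suc k)) (suc k)} → IsPerm ρ →
  (∀ i → 1 ≤ toℕ i → toℕ (lookup ρ i) < b) → k ≤ b
perm-tail-below⇒≤ {b = b} {ρ} ρ-perm tail<b =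
  injective-below⇒≤ (lookup ρ ∘ suc) (Finₚ.suc-injective ∘ ρ-perm) b (λ i → tail<b (suc i) (s≤s z≤n))

perm-tail-below⇒head-max : ∀ {k} {ρ : Vec (Fin (suc k)) (suc k)} → IsPerm ρ →
  (∀ i → 1 ≤ toℕ i → toℕ (lookup ρ i) < k) → lookup ρ zero ≡ fromℕ k
perm-tail-below⇒head-max {k} {ρ} ρ-perm tail<k = Finₚ.toℕ-injective (trans head≡k (sym (Finₚ.toℕ-fromℕ k)))
  where
  head≡k : toℕ (lookup ρ zero) ≡ k
  head≡k = ≤-antisym (≤-pred (Finₚ.toℕ<n (lookup ρ zero))) (≮⇒≥ λ head<k →
    <-irrefl refl (injective-below⇒≤ (lookup ρ) ρ-perm k
      λ { zero → head<k ; (suc i) → tail<k (suc i) (s≤s z≤n) }))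

skipDecreasingPerm-zero-cases : ∀ {k} {π : Vec (Fin (2 + k)) (2 + k)} → SkipDecreasingPerm 0 π →
  Image (SkipDecreasingPerm 0) prependMax π ⊎ Image (SkipDecreasingPerm 0) prepend₂ π
skipDecreasingPerm-zero-cases {k} {π} (π-perm , π-sd) with isPerm⇒prepend {π = π} π-perm
... | v , ρ , ρ-perm , refl with to (skipDecreasing-zero-prepend v ρ) π-sd
...   | ρ-sd , tail<v with m≤n⇒m<n∨m≡n (≤-pred (Finₚ.toℕ<n v))
...     | inj₂ v≡suc-k = inj₁ (ρ , (ρ-perm , ρ-sd) , cong (λ u → prepend u ρ) v-max)
  where
  v-max : fromℕ (suc k) ≡ v
  v-max = Finₚ.toℕ-injective (trans (Finₚ.toℕ-fromℕ (suc k)) (sym v≡suc-k))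
...     | inj₁ v<suc-k with isPerm⇒prepend {π = ρ} ρ-perm
...       | w , σ , σ-perm , refl =
  inj₂ (σ , (σ-perm , σ-sd) , cong₂ prepend v-secondLast (cong (λ u → prepend u σ) w-max))
  where
  v≡k : toℕ v ≡ k
  v≡k = ≤-antisym (≤-pred v<suc-k) (perm-tail-below⇒≤ {ρ = prepend w σ} ρ-perm tail<v)

  v-secondLast : secondLast k ≡ v
  v-secondLast = Finₚ.toℕ-injective (trans (toℕ-secondLast k) (sym v≡k))

  w-max : fromℕ k ≡ w
  w-max = sym (perm-tail-below⇒head-max {ρ = prepend w σ} ρ-perm (λ i 1≤i → subst (_ <_) v≡k (tail<v i 1≤i)))

  σ-sd : SkipDecreasing 0 σ
  σ-sd = proj₁ (to (skipDecreasing-zero-prepend w σ) ρ-sd)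

enumerate-skipDecreasingPerm-zero : ∀ n → Enumeration (SkipDecreasingPerm {n} 0) (F (suc n))
enumerate-skipDecreasingPerm-zero zero = record
  { enum           = λ _ → []
  ; enum-injective = λ { {zero} {zero} _ → refl }
  ; enum-sound     = λ _ → (λ { {()} }) , skipDecreasing-short z≤n []
  ; enum-complete  = λ { [] _ → zero , refl }
  }
enumerate-skipDecreasingPerm-zero (suc zero) = record
  { enum           = λ _ → zero ∷ []
  ; enum-injective = λ { {zero} {zero} _ → refl }
  ; enum-sound     = λ _ → (λ { {zero} {zero} _ → refl }) , skipDecreasing-short (s≤s z≤n) (zero ∷ [])
  ; enum-complete  = λ { (zero ∷ []) _ → zero , refl }
  }
enumerate-skipDecreasingPerm-zero (suc (suc k)) = enumeration-resp classify
  (enumeration-⊎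
    (enumeration-image (enumerate-skipDecreasingPerm-zero (suc k)) prependMax (proj₂ ∘ prepend-injective))
    (enumeration-image (enumerate-skipDecreasingPerm-zero k) prepend₂ (proj₂ ∘ prepend-injective ∘ proj₂ ∘ prepend-injective))
    disjoint)
  where
  disjoint : ∀ {π} → Image (SkipDecreasingPerm 0) prependMax π → Image (SkipDecreasingPerm 0) prepend₂ π → ⊥
  disjoint (_ , _ , refl) (_ , _ , eq) = Finₚ.fromℕ≢inject₁ (sym (cong head eq))

  classify : ∀ π → (Image (SkipDecreasingPerm 0) prependMax π ⊎ Image (SkipDecreasingPerm 0) prepend₂ π)
    ⇔ SkipDecreasingPerm 0 π
  classify π = mk⇔
    (λ { (inj₁ (_ , (ρ-perm , ρ-sd) , refl)) → prepend-isPerm _ ρ-perm , skipDecreasing-prependMax ρ-sd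
       ; (inj₂ (_ , (ρ-perm , ρ-sd) , refl)) → prepend-isPerm _ (prepend-isPerm _ ρ-perm) , skipDecreasing-prepend₂ ρ-sd })
    skipDecreasingPerm-zero-cases

[1+n]P[1+s]≡[1+n]*nPs : ∀ {n s} → s ≤ n → suc n P suc s ≡ suc n * (n P s)
[1+n]P[1+s]≡[1+n]*nPs {n} {s} s≤n = begin
  suc n P suc s             ≡⟨ nPk≡n!/[n∸k]! (s≤s s≤n) ⟩
  suc n ! / (n ∸ s) !       ≡⟨ *-/-assoc (suc n) (m≤n⇒m!∣n! (m∸n≤m n s)) ⟩
  suc n * (n ! / (n ∸ s) !) ≡⟨ cong (suc n *_) (nPk≡n!/[n∸k]! s≤n) ⟨
  suc n * (n P s)           ∎
  where
  open ≡-Reasoning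
  instance _ = (n ∸ s) !≢0

enumerate-skipDecreasingPerm : ∀ n s → s ≤ n → Enumeration (SkipDecreasingPerm {n} s) ((n P s) * F (suc (n ∸ s)))
enumerate-skipDecreasingPerm n zero _ = subst (Enumeration _) count (enumerate-skipDecreasingPerm-zero n)
  where
  count : F (suc n) ≡ (n P 0) * F (suc n)
  count = sym (*-identityˡ (F (suc n)))
enumerate-skipDecreasingPerm (suc n) (suc s) (s≤s s≤n) = subst (Enumeration _) count (enumeration-resp classify
  (enumeration-image (enumeration-× (suc n) (enumerate-skipDecreasingPerm n s s≤n)) (uncurry prepend) prepend-injective′))
  where
  count : suc n * ((n P s) * F (suc (n ∸ s))) ≡ (suc n P suc s) * F (suc (n ∸ s))
  count = trans (sym (*-assoc (suc n) (n P s) _)) (cong (_* F (suc (n ∸ s))) (sym ([1+n]P[1+s]≡[1+n]*nPs s≤n)))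

  prepend-injective′ : Injective _≡_ _≡_ (uncurry prepend)
  prepend-injective′ eq with prepend-injective eq
  ... | refl , refl = refl

  classify : ∀ π → Image (SkipDecreasingPerm s ∘ proj₂) (uncurry prepend) π ⇔ SkipDecreasingPerm (suc s) π
  classify π = mk⇔
    (λ { ((v , ρ) , (ρ-perm , ρ-sd) , refl) → prepend-isPerm v ρ-perm , from (skipDecreasing-suc-prepend v ρ) ρ-sd })
    (λ (π-perm , π-sd) → prepended π-perm π-sd)
    where
    prepended : IsPerm π → SkipDecreasing (suc s) π → Image (SkipDecreasingPerm s ∘ proj₂) (uncurry prepend) π
    prepended π-perm π-sd with isPerm⇒prepend {π = π} π-perm
    ... | v , ρ , ρ-perm , refl = (v , ρ) , (ρ-perm , to (skipDecreasing-suc-prepend v ρ) π-sd) , refl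

enumerate-skipDecreasingPerm-short : ∀ {n s} → n ≤ 2 + s → Enumeration (SkipDecreasingPerm {n} s) (n !)
enumerate-skipDecreasingPerm-short {n} n≤2+s = subst (Enumeration _) count
  (enumeration-resp (λ ρ → mk⇔ (map₂ λ _ → skipDecreasing-short n≤2+s ρ)
                               (map₂ λ _ → skipDecreasing-short (m≤n+m n 2) ρ))
    (enumerate-skipDecreasingPerm n n ≤-refl))
  where
  count : (n P n) * F (suc (n ∸ n)) ≡ n !
  count = trans (cong₂ _*_ (nPn≡n! n) (cong (F ∘ suc) (n∸n≡0 n))) (*-identityʳ (n !))

GapIncreasing : ∀ {n} → ℕ → Vec (Fin n) n → Set
GapIncreasing {n} s y = ∀ (a c : Fin n) → 2 + toℕ a ≤ toℕ c → toℕ c + s < n → lookup y a <ᶠ lookup y c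

StrictlyIncreasing : ∀ {k n} → (Fin k → Fin n) → Set
StrictlyIncreasing {k} f = ∀ (a b : Fin k) → a <ᶠ b → f a <ᶠ f b

strictlyIncreasing-headroom : ∀ {k n} (f : Fin k → Fin n) → StrictlyIncreasing f →
  ∀ d (t : Fin k) → toℕ t + d < k → toℕ (f t) + d < n
strictlyIncreasing-headroom {k} {n} f f-inc zero t _ = subst (_< n) (sym (+-identityʳ _)) (Finₚ.toℕ<n (f t))
strictlyIncreasing-headroom {k} {n} f f-inc (suc d) t t+[1+d]<k = begin-strict
  toℕ (f t) + suc d   ≡⟨ +-suc (toℕ (f t)) d ⟩
  suc (toℕ (f t)) + d ≤⟨ +-monoˡ-≤ d (f-inc t t′ t<t′) ⟩
  toℕ (f t′) + d      <⟨ strictlyIncreasing-headroom f f-inc d t′ t′+d<k ⟩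
  n                   ∎
  where
  open ≤-Reasoning

  1+t+d<k : suc (toℕ t) + d < k
  1+t+d<k = subst (_< k) (+-suc (toℕ t) d) t+[1+d]<k

  t+1<k : suc (toℕ t) < k
  t+1<k = ≤-<-trans (m≤m+n (suc (toℕ t)) d) 1+t+d<k

  t′ : Fin k
  t′ = fromℕ< t+1<k

  t<t′ : t <ᶠ t′
  t<t′ = subst (toℕ t <_) (sym (Finₚ.toℕ-fromℕ< t+1<k)) (n<1+n (toℕ t))

  t′+d<k : toℕ t′ + d < k
  t′+d<k = subst (λ x → x + d < k) (sym (Finₚ.toℕ-fromℕ< t+1<k)) 1+t+d<k

gapIncreasing⇒avoids : ∀ {n s} {y : Vec (Fin n) n} → GapIncreasing s y → Avoids (p13 (3 + s)) y
gapIncreasing⇒avoids {s = s} gi (i , i-inc , i-rel) = <-asym (i-rel third first (refl , refl))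
  (gi (i first) (i third) (≤-trans (s≤s (i-inc first second (s≤s z≤n))) (i-inc second third (s≤s (s≤s z≤n))))
      (strictlyIncreasing-headroom i i-inc s third ≤-refl))
  where
  first second third : Fin (3 + s)
  first  = zero
  second = suc zero
  third  = suc (suc zero)

inversion⇒occurs-p13 : ∀ {n s} (y : Vec (Fin n) n) (a c : Fin n) → 2 + toℕ a ≤ toℕ c → toℕ c + s < n →
  lookup y c <ᶠ lookup y a → Occurs (p13 (3 + s)) y
inversion⇒occurs-p13 {n} {s} y a c 2+a≤c c+s<n yc<ya = pos , pos-inc , pos-rel
  where
  a+1<n : suc (toℕ a) < n
  a+1<n = ≤-trans 2+a≤c (<⇒≤ (Finₚ.toℕ<n c))

  c+t<n : ∀ (t : Fin (suc s)) → toℕ c + toℕ t < n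
  c+t<n t = ≤-<-trans (+-monoʳ-≤ (toℕ c) (≤-pred (Finₚ.toℕ<n t))) c+s<n

  pos : Fin (3 + s) → Fin n
  pos zero          = a
  pos (suc zero)    = fromℕ< a+1<n
  pos (suc (suc t)) = fromℕ< (c+t<n t)

  toℕ-pos₁ : toℕ (pos (suc zero)) ≡ suc (toℕ a)
  toℕ-pos₁ = Finₚ.toℕ-fromℕ< a+1<n

  toℕ-pos₂ : ∀ t → toℕ (pos (suc (suc t))) ≡ toℕ c + toℕ t
  toℕ-pos₂ t = Finₚ.toℕ-fromℕ< (c+t<n t)

  pos-inc : StrictlyIncreasing pos
  pos-inc zero (suc zero) _ = subst (toℕ a <_) (sym toℕ-pos₁) ≤-refl
  pos-inc zero (suc (suc t)) _ =
    subst (toℕ a <_) (sym (toℕ-pos₂ t)) (≤-trans (n≤1+n _) (≤-trans 2+a≤c (m≤m+n _ _)))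
  pos-inc (suc zero) (suc zero) (s≤s ())
  pos-inc (suc zero) (suc (suc t)) _ = subst₂ _<_ (sym toℕ-pos₁) (sym (toℕ-pos₂ t)) (≤-trans 2+a≤c (m≤m+n _ _))
  pos-inc (suc (suc t)) (suc (suc t′)) (s≤s (s≤s t<t′)) =
    subst₂ _<_ (sym (toℕ-pos₂ t)) (sym (toℕ-pos₂ t′)) (+-monoʳ-< (toℕ c) t<t′)

  pos-rel : ∀ x z → p13 (3 + s) x z → lookup y (pos x) <ᶠ lookup y (pos z)
  pos-rel zero                _       (() , _)
  pos-rel (suc zero)          _       (() , _)
  pos-rel (suc (suc (suc t))) _       (() , _)
  pos-rel (suc (suc zero))    (suc z) (_ , ())
  pos-rel (suc (suc zero))    zero    _ = subst (λ w → lookup y w <ᶠ lookup y a) (sym pos₂≡c) yc<ya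
    where
    pos₂≡c : pos (suc (suc zero)) ≡ c
    pos₂≡c = Finₚ.toℕ-injective (trans (toℕ-pos₂ zero) (+-identityʳ (toℕ c)))

avoids⇒gapIncreasing : ∀ {n s} {y : Vec (Fin n) n} → IsPerm y → Avoids (p13 (3 + s)) y → GapIncreasing s y
avoids⇒gapIncreasing {y = y} y-perm avoids a c 2+a≤c c+s<n with Finₚ.<-cmp (lookup y a) (lookup y c)
... | tri< ya<yc _ _ = ya<yc
... | tri≈ _ ya≡yc _ = ⊥-elim (<-irrefl (cong toℕ (y-perm ya≡yc)) (≤-trans (n≤1+n _) 2+a≤c))
... | tri> _ _ yc<ya = ⊥-elim (avoids (inversion⇒occurs-p13 y a c 2+a≤c c+s<n yc<ya))

involutive⇒injective : {A : Set} (f : A → A) → (∀ x → f (f x) ≡ x) → Injective _≡_ _≡_ f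
involutive⇒injective f f-involutive = inverseʳ⇒injective f (strictlyInverseʳ⇒inverseʳ {f⁻¹ = f} f f-involutive)

reverse : ∀ {n} → Vec (Fin n) n → Vec (Fin n) n
reverse π = tabulate (lookup π ∘ opposite)

lookup-reverse : ∀ {n} (π : Vec (Fin n) n) i → lookup (reverse π) i ≡ lookup π (opposite i)
lookup-reverse π = lookup∘tabulate (lookup π ∘ opposite)

reverse-involutive : ∀ {n} (π : Vec (Fin n) n) → reverse (reverse π) ≡ π
reverse-involutive π = begin
  tabulate (lookup (reverse π) ∘ opposite) ≡⟨ tabulate-cong (λ i → trans (lookup-reverse π (opposite i))
                                                                        (cong (lookup π) (Finₚ.opposite-involutive i))) ⟩
  tabulate (lookup π)                     ≡⟨ tabulate∘lookup π ⟩
  π                                       ∎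
  where open ≡-Reasoning

reverse-injective : ∀ {n} → Injective _≡_ _≡_ (reverse {n})
reverse-injective = involutive⇒injective reverse reverse-involutive

reverse-isPerm : ∀ {n} {π : Vec (Fin n) n} → IsPerm π → IsPerm (reverse π)
reverse-isPerm {π = π} π-perm {i} {j} eq = involutive⇒injective opposite Finₚ.opposite-involutive
  (π-perm (trans (sym (lookup-reverse π i)) (trans eq (lookup-reverse π j))))

toℕ-opposite-+-suc : ∀ {n} (x : Fin n) → toℕ (opposite x) + suc (toℕ x) ≡ n
toℕ-opposite-+-suc x = trans (cong (_+ suc (toℕ x)) (Finₚ.opposite-prop x)) (m∸n+n≡m (Finₚ.toℕ<n x))

opposite-+-≤ : ∀ {n d} {x y : Fin n} → d + toℕ x ≤ toℕ y → d + toℕ (opposite y) ≤ toℕ (opposite x)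
opposite-+-≤ {n} {d} {x} {y} d+x≤y = +-cancelʳ-≤ (suc (toℕ x)) (d + toℕ (opposite y)) (toℕ (opposite x)) (begin
  d + toℕ (opposite y) + suc (toℕ x)   ≡⟨ cong (_+ suc (toℕ x)) (+-comm d (toℕ (opposite y))) ⟩
  toℕ (opposite y) + d + suc (toℕ x)   ≡⟨ +-assoc (toℕ (opposite y)) d (suc (toℕ x)) ⟩
  toℕ (opposite y) + (d + suc (toℕ x)) ≡⟨ cong (toℕ (opposite y) +_) (+-suc d (toℕ x)) ⟩
  toℕ (opposite y) + suc (d + toℕ x)   ≤⟨ +-monoʳ-≤ (toℕ (opposite y)) (s≤s d+x≤y) ⟩
  toℕ (opposite y) + suc (toℕ y)       ≡⟨ toℕ-opposite-+-suc y ⟩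
  n                                    ≡⟨ toℕ-opposite-+-suc x ⟨
  toℕ (opposite x) + suc (toℕ x)       ∎)
  where open ≤-Reasoning

≤-toℕ⇒opposite-+-< : ∀ {n s} {x : Fin n} → s ≤ toℕ x → toℕ (opposite x) + s < n
≤-toℕ⇒opposite-+-< {x = x} s≤x = ≤-<-trans (+-monoʳ-≤ (toℕ (opposite x)) s≤x)
  (subst (toℕ (opposite x) + toℕ x <_) (toℕ-opposite-+-suc x) (+-monoʳ-< (toℕ (opposite x)) (n<1+n (toℕ x))))

+-<⇒≤-toℕ-opposite : ∀ {n s} {x : Fin n} → toℕ x + s < n → s ≤ toℕ (opposite x)
+-<⇒≤-toℕ-opposite {n} {s} {x} x+s<n = +-cancelʳ-≤ (suc (toℕ x)) s (toℕ (opposite x)) (begin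
  s + suc (toℕ x)                ≡⟨ +-suc s (toℕ x) ⟩
  suc (s + toℕ x)                ≡⟨ cong suc (+-comm s (toℕ x)) ⟩
  suc (toℕ x + s)                ≤⟨ x+s<n ⟩
  n                              ≡⟨ toℕ-opposite-+-suc x ⟨
  toℕ (opposite x) + suc (toℕ x) ∎)
  where open ≤-Reasoning

skipDecreasing⇒gapIncreasing-reverse : ∀ {n s} {ρ : Vec (Fin n) n} → SkipDecreasing s ρ → GapIncreasing s (reverse ρ)
skipDecreasing⇒gapIncreasing-reverse {ρ = ρ} sd a c 2+a≤c c+s<n =
  subst₂ _<ᶠ_ (sym (lookup-reverse ρ a)) (sym (lookup-reverse ρ c))
  (sd (opposite c) (opposite a) (+-<⇒≤-toℕ-opposite c+s<n) (opposite-+-≤ 2+a≤c))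

gapIncreasing⇒skipDecreasing-reverse : ∀ {n s} {y : Vec (Fin n) n} → GapIncreasing s y → SkipDecreasing s (reverse y)
gapIncreasing⇒skipDecreasing-reverse {y = y} gi j i s≤j 2+j≤i =
  subst₂ _<ᶠ_ (sym (lookup-reverse y i)) (sym (lookup-reverse y j))
  (gi (opposite i) (opposite j) (opposite-+-≤ 2+j≤i) (≤-toℕ⇒opposite-+-< s≤j))

numAvoiders-p13 : ∀ {n s m} → Enumeration (SkipDecreasingPerm {n} s) m → NumAvoiders (p13 (3 + s)) n m
numAvoiders-p13 E = numAvoiders (enumeration-resp classify (enumeration-image E reverse reverse-injective))
  where
  classify : ∀ y → Image (SkipDecreasingPerm _) reverse y ⇔ (IsPerm y × Avoids (p13 _) y)
  classify y = mk⇔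
    (λ { (ρ , (ρ-perm , ρ-sd) , refl) →
           reverse-isPerm {π = ρ} ρ-perm ,
           gapIncreasing⇒avoids {y = reverse ρ} (skipDecreasing⇒gapIncreasing-reverse {ρ = ρ} ρ-sd) })
    (λ (y-perm , y-avoids) →
       reverse y ,
       (reverse-isPerm {π = y} y-perm ,
        gapIncreasing⇒skipDecreasing-reverse {y = y} (avoids⇒gapIncreasing {y = y} y-perm y-avoids)) ,
       reverse-involutive y)

formula≡P*F : ∀ s n → 3 + s ≤ n → formula (3 + s) n ≡ (n P s) * F (suc (n ∸ s))
formula≡P*F s n 3+s≤n = begin
  formula (3 + s) n                                    ≡⟨ cong (λ x → (n ! / m !) {{m !≢0}} * F x) (+-suc (n ∸ (3 + s)) 3) ⟩
  (n ! / m !) {{m !≢0}} * F (suc m)                   ≡⟨ cong (λ x → (n ! / x !) {{x !≢0}} * F (suc x)) m≡n∸s ⟩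
  (n ! / (n ∸ s) !) {{(n ∸ s) !≢0}} * F (suc (n ∸ s)) ≡⟨ cong (_* F (suc (n ∸ s))) (nPk≡n!/[n∸k]! (m+n≤o⇒n≤o 3 3+s≤n)) ⟨
  (n P s) * F (suc (n ∸ s))                           ∎
  where
  open ≡-Reasoning

  m : ℕ
  m = n ∸ (3 + s) + 3

  m≡n∸s : m ≡ n ∸ s
  m≡n∸s = begin
    n ∸ (3 + s) + 3 ≡⟨ cong (λ x → n ∸ x + 3) (+-comm 3 s) ⟩
    n ∸ (s + 3) + 3 ≡⟨ cong (_+ 3) (∸-+-assoc n s 3) ⟨
    n ∸ s ∸ 3 + 3   ≡⟨ m∸n+n≡m (m+n≤o⇒m≤o∸n 3 3+s≤n) ⟩
    n ∸ s           ∎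

theorem5 : (k : ℕ) → 3 ≤ k → (n : ℕ) →
    (n < k → NumAvoiders (p13 k) n (n !)) ×
    (k ≤ n → NumAvoiders (p13 k) n (formula k n))
theorem5 (suc (suc (suc s))) (s≤s (s≤s (s≤s z≤n))) n =
  (λ n<k → numAvoiders-p13 (enumerate-skipDecreasingPerm-short (≤-pred n<k))) ,
  (λ k≤n → numAvoiders-p13 (subst (Enumeration _) (sym (formula≡P*F s n k≤n))
                                   (enumerate-skipDecreasingPerm n s (m+n≤o⇒n≤o 3 k≤n))))
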